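{- Let $k\geq 2$ and let $n=km$ with $m\geq 1$. Then \[\rho_n^{ab}(\mathbf{t}^{(k)})=1+\sum_{t=1}^{\lfloor k/2\rfloor}k(k-2t+1)=\begin{cases}1+\frac14k^3 & \text{if $k$ is even},\\ 1+\frac14k(k^2-1) & \text{if $k$ is odd}.\end{cases}\]
   Context: Let $\sigma_k$ be the morphism on $\{0,\dots,k-1\}^*$ with $\sigma_k(i)=i(i+1)\cdots(i+k-1)$ (letters mod $k$), and $\mathbf{t}^{(k)}=\sigma_k^\infty(0)$ its fixed point starting with $0$. For a word $v$, $\psi(v)=(|v|_0,\dots,|v|_{k-1})$; $\mathcal{F}_n(\mathbf{w})$ is the set of length-$n$ factors of $\mathbf{w}$; $\rho_n^{ab}(\mathbf{w})=\#\{\psi(v):v\in\mathcal{F}_n(\mathbf{w})\}$. -}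

module Defs where

open import Data.Nat using (ℕ; zero; suc; _+_; _*_; _∸_; _<ᵇ_)
open import Data.Nat.Properties using (_≟_)
open import Data.Bool using (if_then_else_)
open import Data.List using (List; []; _∷_; map; upTo; concatMap; length; filter)
open import Function using (_∘_)

-- (a + b) mod k, for letters a, b < k (so a + b < 2k).
addMod : ℕ → ℕ → ℕ → ℕ
addMod k a b = if (a + b) <ᵇ k then a + b else (a + b) ∸ k

σ : ℕ → ℕ → List ℕ
σ k i = map (addMod k i) (upTo k)

σ* : ℕ → List ℕ → List ℕ
σ* k = concatMap (σ k)

σ^ : ℕ → ℕ → List ℕ
σ^ k zero    = 0 ∷ []
σ^ k (suc j) = σ* k (σ^ k j)

-- i-th letter of a word (default 0 if out of range; never used out of range below)
nth : List ℕ → ℕ → ℕ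
nth []       _       = 0
nth (x ∷ xs) zero    = x
nth (x ∷ xs) (suc i) = nth xs i

-- t^(k)(i) = i-th letter of the fixed point σ_k^∞(0).
-- σ_k^(i+1)(0) is a prefix of the fixed point of length k^(i+1) > i (for k ≥ 2).
t : ℕ → ℕ → ℕ
t k i = nth (σ^ k (suc i)) i

factor : ℕ → ℕ → ℕ → List ℕ
factor k i n = map (λ j → t k (i + j)) (upTo n)

count : ℕ → List ℕ → ℕ
count c v = length (filter (λ x → x ≟ c) v)

ψ : ℕ → List ℕ → List ℕ
ψ k v = map (λ c → count c v) (upTo k)

module Submission where

-- The fixed point satisfies t (q k + r) ≡ t q + r (mod k), so t is the base-k digit sum mod k.
-- The factor of length k m at position q k + r is σ(t q ⋯ t (q + m - 1)) with the first r
-- letters of σ(t q) removed and the first r letters of σ(t (q + m)) appended. As σ(x) contains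
-- every letter once, its Parikh vector is m + 1_B - 1_A for the cyclic arcs A and B of length r
-- of ℤ/kℤ starting at t q and t (q + m), and every pair of values (t q, t (q + m)) occurs.
-- Such a vector is constant if A = B; otherwise cancelling the overlap of A and B, after
-- replacing both by their complements if necessary, rewrites it with disjoint arcs of a common
-- length s ≤ k/2, which it then determines. For each s there are k (k - 2s + 1) such pairs.

open import Defs
open import Data.Nat
  using (ℕ; zero; suc; _+_; _*_; _∸_; _^_; _≤_; _<_; z≤n; s≤s; z<s; s≤s⁻¹; _<ᵇ_; NonZero; >-nonZero⁻¹)
open import Data.Nat.Properties
open import Data.Nat.DivMod
open import Data.Nat.ListAction using (sum)
open import Data.Nat.ListAction.Properties using (sum-++)
open import Data.Nat.Tactic.RingSolver using (solve-∀)
open import Data.Bool using (true; false; T)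
open import Data.Unit using (tt)
open import Data.Product using (Σ; ∃; _×_; _,_; proj₁; proj₂)
open import Data.Sum using (_⊎_; inj₁; inj₂)
open import Data.List using (List; []; _∷_; _++_; map; upTo; applyUpTo; length; concatMap; filter)
open import Data.List.Properties
  using (length-map; length-upTo; length-++; map-upTo; map-++; map-cong; upTo-∷ʳ; concatMap-++;
         filter-++; filter-accept; filter-reject)
open import Data.List.Relation.Unary.All as All using (All; []; _∷_)
import Data.List.Relation.Unary.All.Properties as All
open import Data.List.Relation.Unary.Any using (here; there)
open import Data.List.Relation.Unary.Unique.Propositional using (Unique; []; _∷_)
import Data.List.Relation.Unary.Unique.Propositional.Properties as Unique
open import Data.List.Membership.Propositional using (_∈_; find; lose)
open import Data.List.Membership.Propositional.Properties
  using (∈-map⁺; ∈-map⁻; ∈-concatMap⁺; ∈-concatMap⁻; ∈-upTo⁺; ∈-upTo⁻)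
open import Function.Base using (_∘_)
open import Function.Bundles using (_⇔_; mk⇔; module Equivalence)
open import Relation.Nullary using (¬_; yes; no)
open import Relation.Nullary.Negation using (contradiction)
open import Relation.Binary.Definitions using (tri<; tri≈; tri>)
open import Relation.Binary.PropositionalEquality

Unique-map⁺-on : ∀ {A B : Set} {P : A → Set} (f : A → B) {xs} →
                 (∀ {x y} → P x → P y → f x ≡ f y → x ≡ y) →
                 All P xs → Unique xs → Unique (map f xs)
Unique-map⁺-on f inj [] [] = []
Unique-map⁺-on f {x ∷ xs} inj (px ∷ pxs) (x∉ ∷ xs!) =
  All.map⁺ (All.zipWith (λ (py , x≢y) fx≡fy → x≢y (inj px py fx≡fy)) (pxs , x∉))
    ∷ Unique-map⁺-on f inj pxs xs!

Unique-concatMap⁺ : ∀ {A B : Set} (f : A → List B) (tag : B → A) →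
                    (∀ {x b} → b ∈ f x → tag b ≡ x) →
                    (∀ x → Unique (f x)) → ∀ {xs} → Unique xs → Unique (concatMap f xs)
Unique-concatMap⁺ f tag tag-f f! [] = []
Unique-concatMap⁺ f tag tag-f f! {x ∷ xs} (x∉ ∷ xs!) =
  Unique.++⁺ (f! x) (Unique-concatMap⁺ f tag tag-f f! xs!) disjoint
  where
  disjoint : ∀ {b} → ¬ (b ∈ f x × b ∈ concatMap f xs)
  disjoint (b∈fx , b∈rest) with find (∈-concatMap⁻ f {xs = xs} b∈rest)
  ... | y , y∈xs , b∈fy = All.lookup x∉ y∈xs (trans (sym (tag-f b∈fx)) (tag-f b∈fy))

length-concatMap : ∀ {A B : Set} (f : A → List B) xs →
                   length (concatMap f xs) ≡ sum (map (λ x → length (f x)) xs)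
length-concatMap f []       = refl
length-concatMap f (x ∷ xs) = trans (length-++ (f x)) (cong (length (f x) +_) (length-concatMap f xs))

sum-map-const : ∀ {A : Set} (c : ℕ) (xs : List A) → sum (map (λ _ → c) xs) ≡ length xs * c
sum-map-const c []       = refl
sum-map-const c (x ∷ xs) = cong (c +_) (sum-map-const c xs)

nth-applyUpTo : ∀ (f : ℕ → ℕ) {n c} → c < n → nth (applyUpTo f n) c ≡ f c
nth-applyUpTo f {suc n} {zero}  _         = refl
nth-applyUpTo f {suc n} {suc c} (s≤s c<n) = nth-applyUpTo (λ x → f (suc x)) c<n

nth-map-upTo : ∀ (f : ℕ → ℕ) {n c} → c < n → nth (map f (upTo n)) c ≡ f c
nth-map-upTo f {n} c<n = trans (cong (λ l → nth l _) (map-upTo f n)) (nth-applyUpTo f c<n)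

nth-++ˡ : ∀ (xs ys : List ℕ) {i} → i < length xs → nth (xs ++ ys) i ≡ nth xs i
nth-++ˡ (x ∷ xs) ys {zero}  _         = refl
nth-++ˡ (x ∷ xs) ys {suc i} (s≤s i<n) = nth-++ˡ xs ys i<n

nth-++ʳ : ∀ (xs ys : List ℕ) i → nth (xs ++ ys) (length xs + i) ≡ nth ys i
nth-++ʳ []       ys i = refl
nth-++ʳ (x ∷ xs) ys i = nth-++ʳ xs ys i

nth-All : ∀ {P : ℕ → Set} {xs i} → i < length xs → All P xs → P (nth xs i)
nth-All {i = zero}  _         (p ∷ _)  = p
nth-All {i = suc i} (s≤s i<n) (_ ∷ ps) = nth-All i<n ps

map-upTo-cong : ∀ {n} (f g : ℕ → ℕ) → (∀ {c} → c < n → f c ≡ g c) → map f (upTo n) ≡ map g (upTo n)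
map-upTo-cong {n} f g f≗g = trans (map-upTo f n) (trans (applyUpTo-cong n f g f≗g) (sym (map-upTo g n)))
  where
  applyUpTo-cong : ∀ n (f g : ℕ → ℕ) → (∀ {c} → c < n → f c ≡ g c) → applyUpTo f n ≡ applyUpTo g n
  applyUpTo-cong zero    f g f≗g = refl
  applyUpTo-cong (suc n) f g f≗g =
    cong₂ _∷_ (f≗g z<s) (applyUpTo-cong n (λ x → f (suc x)) (λ x → g (suc x)) (λ c<n → f≗g (s≤s c<n)))

map-upTo-cong⁻ : ∀ {n} (f g : ℕ → ℕ) → map f (upTo n) ≡ map g (upTo n) → ∀ {c} → c < n → f c ≡ g c
map-upTo-cong⁻ f g f≡g c<n =
  trans (sym (nth-map-upTo f c<n)) (trans (cong (λ l → nth l _) f≡g) (nth-map-upTo g c<n))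

count-∷-≡ : ∀ {x c} → x ≡ c → count c (x ∷ []) ≡ 1
count-∷-≡ {c = c} x≡c = cong length (filter-accept (_≟ c) x≡c)

count-∷-≢ : ∀ {x c} → x ≢ c → count c (x ∷ []) ≡ 0
count-∷-≢ {c = c} x≢c = cong length (filter-reject (_≟ c) x≢c)

count-∷-cong : ∀ {x c y d} → (x ≡ c → y ≡ d) → (y ≡ d → x ≡ c) → count c (x ∷ []) ≡ count d (y ∷ [])
count-∷-cong {x} {c} to from with x ≟ c
... | yes x≡c = trans (count-∷-≡ x≡c) (sym (count-∷-≡ (to x≡c)))
... | no  x≢c = trans (count-∷-≢ x≢c) (sym (count-∷-≢ (λ y≡d → x≢c (from y≡d))))

count-++ : ∀ c xs ys → count c (xs ++ ys) ≡ count c xs + count c ys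
count-++ c xs ys = trans (cong length (filter-++ (_≟ c) xs ys)) (length-++ (filter (_≟ c) xs))

∸-exchange : ∀ m {p p′ q q′} → p + p′ ≡ q + q′ → (m + p) ∸ q ≡ (m + q′) ∸ p′
∸-exchange m {p} {p′} {q} {q′} eq = begin
  (m + p) ∸ q                ≡⟨ [m+n]∸[m+o]≡n∸o q′ (m + p) q ⟨
  (q′ + (m + p)) ∸ (q′ + q)  ≡⟨ cong₂ _∸_ (shuffle q′ m p) (trans (+-comm q′ q) (sym eq)) ⟩
  (p + (m + q′)) ∸ (p + p′)  ≡⟨ [m+n]∸[m+o]≡n∸o p (m + q′) p′ ⟩
  (m + q′) ∸ p′              ∎
  where
  open ≡-Reasoning
  shuffle : ∀ a b c → a + (b + c) ≡ c + (b + a)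
  shuffle = solve-∀

∸-decode : ∀ {m p q} → 1 ≤ m → p ≤ 1 → q ≤ 1 → (p ≡ 1 → q ≡ 0) →
           ((m + p) ∸ q) ∸ m ≡ p × m ∸ ((m + p) ∸ q) ≡ q
∸-decode {suc m} _ z≤n       z≤n       _ = m+n∸m≡n m 0 , m≤n⇒m∸n≡0 (m≤m+n m 0)
∸-decode {suc m} _ (s≤s z≤n) z≤n       _ = m+n∸m≡n m 1 , m≤n⇒m∸n≡0 (m≤m+n m 1)
∸-decode {suc m} _ z≤n       (s≤s z≤n) _ =
  m≤n⇒m∸n≡0 (≤-trans (≤-reflexive (+-identityʳ m)) (n≤1+n m)) ,
  trans (cong (suc m ∸_) (+-identityʳ m)) (m+n∸n≡m 1 m)
∸-decode {suc m} _ (s≤s z≤n) (s≤s z≤n) p≡1⇒q≡0 with p≡1⇒q≡0 refl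
... | ()

𝟙[_<_] : ℕ → ℕ → ℕ
𝟙[ u < r ] with u <? r
... | yes _ = 1
... | no  _ = 0

𝟙-< : ∀ {u r} → u < r → 𝟙[ u < r ] ≡ 1
𝟙-< {u} {r} u<r with u <? r
... | yes _   = refl
... | no  u≮r = contradiction u<r u≮r

𝟙-≥ : ∀ {u r} → r ≤ u → 𝟙[ u < r ] ≡ 0
𝟙-≥ {u} {r} r≤u with u <? r
... | yes u<r = contradiction u<r (≤⇒≯ r≤u)
... | no  _   = refl

𝟙≡1⇒< : ∀ {u r} → 𝟙[ u < r ] ≡ 1 → u < r
𝟙≡1⇒< {u} {r} eq with u <? r
... | yes u<r = u<r

𝟙≤1 : ∀ u r → 𝟙[ u < r ] ≤ 1
𝟙≤1 u r with u <? r
... | yes _ = ≤-refl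
... | no  _ = z≤n

𝟙-∸ : ∀ {u d e} → d ≤ u → 𝟙[ u ∸ d < e ] ≡ 𝟙[ u < d + e ]
𝟙-∸ {u} {d} {e} d≤u with u <? d + e
... | yes u<d+e = 𝟙-< (+-cancelˡ-< d (u ∸ d) e (subst (_< d + e) (sym (m+[n∸m]≡n d≤u)) u<d+e))
... | no  u≮d+e = 𝟙-≥ (+-cancelˡ-≤ d e (u ∸ d) (subst (d + e ≤_) (sym (m+[n∸m]≡n d≤u)) (≮⇒≥ u≮d+e)))

𝟙-suc : ∀ u r → 𝟙[ u < suc r ] ≡ 𝟙[ u < r ] + count u (r ∷ [])
𝟙-suc u r with <-cmp u r
... | tri< u<r u≢r _ =
  trans (𝟙-< (m<n⇒m<1+n u<r)) (sym (cong₂ _+_ (𝟙-< u<r) (count-∷-≢ (≢-sym u≢r))))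
... | tri≈ _ u≡r _ =
  trans (𝟙-< (s≤s (≤-reflexive u≡r))) (sym (cong₂ _+_ (𝟙-≥ (≤-reflexive (sym u≡r))) (count-∷-≡ (sym u≡r))))
... | tri> _ u≢r r<u =
  trans (𝟙-≥ r<u) (sym (cong₂ _+_ (𝟙-≥ (<⇒≤ r<u)) (count-∷-≢ (≢-sym u≢r))))

-- Cyclic arcs of ℤ/kℤ

module Cyclic (k : ℕ) .{{_ : NonZero k}} where

  _≈_ : ℕ → ℕ → Set
  a ≈ b = a % k ≡ b % k

  [m%k+n]%k≡[m+n]%k : ∀ a b → (a % k + b) % k ≡ (a + b) % k
  [m%k+n]%k≡[m+n]%k a b = begin
    (a % k + b) % k          ≡⟨ %-distribˡ-+ (a % k) b k ⟩
    (a % k % k + b % k) % k  ≡⟨ cong (λ z → (z + b % k) % k) (m%n%n≡m%n a k) ⟩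
    (a % k + b % k) % k      ≡⟨ %-distribˡ-+ a b k ⟨
    (a + b) % k              ∎
    where open ≡-Reasoning

  [m+n%k]%k≡[m+n]%k : ∀ a b → (a + b % k) % k ≡ (a + b) % k
  [m+n%k]%k≡[m+n]%k a b =
    trans (cong (_% k) (+-comm a (b % k))) (trans ([m%k+n]%k≡[m+n]%k b a) (cong (_% k) (+-comm b a)))

  ≈-+ʳ : ∀ {a b} c → a ≈ b → (a + c) ≈ (b + c)
  ≈-+ʳ {a} {b} c a≈b =
    trans (sym ([m%k+n]%k≡[m+n]%k a c)) (trans (cong (λ z → (z + c) % k) a≈b) ([m%k+n]%k≡[m+n]%k b c))

  m%k≈m : ∀ a → (a % k) ≈ a
  m%k≈m a = m%n%n≡m%n a k

  ≈⇒≡ : ∀ {a b} → a < k → b < k → a ≈ b → a ≡ b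
  ≈⇒≡ a<k b<k a≈b = trans (sym (m<n⇒m%n≡m a<k)) (trans a≈b (m<n⇒m%n≡m b<k))

  +-complement : ∀ y x → (y + x + (k ∸ x % k)) % k ≡ y % k
  +-complement y x = begin
    (y + x + (k ∸ x % k)) % k    ≡⟨ cong (_% k) (+-assoc y x _) ⟩
    (y + (x + (k ∸ x % k))) % k  ≡⟨ cong (λ z → (y + z) % k) complement ⟩
    (y + suc (x / k) * k) % k    ≡⟨ [m+kn]%n≡m%n y (suc (x / k)) k ⟩
    y % k                        ∎
    where
    open ≡-Reasoning
    swap : ∀ a b c → a + b + c ≡ (a + c) + b
    swap = solve-∀
    complement : x + (k ∸ x % k) ≡ suc (x / k) * k
    complement = begin
      x + (k ∸ x % k)                  ≡⟨ cong (_+ (k ∸ x % k)) (m≡m%n+[m/n]*n x k) ⟩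
      x % k + x / k * k + (k ∸ x % k)  ≡⟨ swap (x % k) (x / k * k) (k ∸ x % k) ⟩
      x % k + (k ∸ x % k) + x / k * k  ≡⟨ cong (_+ x / k * k) (m+[n∸m]≡n (m%n≤n x k)) ⟩
      k + x / k * k                    ∎

  -- offset x c is the residue u < k with x + u ≡ c (mod k).
  offset : ℕ → ℕ → ℕ
  offset x c = (c + (k ∸ x % k)) % k

  offset<k : ∀ x c → offset x c < k
  offset<k x c = m%n<n _ k

  offset-spec : ∀ x c → (x + offset x c) ≈ c
  offset-spec x c = begin
    (x + (c + (k ∸ x % k)) % k) % k  ≡⟨ [m+n%k]%k≡[m+n]%k x _ ⟩
    (x + (c + (k ∸ x % k))) % k      ≡⟨ cong (_% k) (swap x c (k ∸ x % k)) ⟩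
    (c + x + (k ∸ x % k)) % k        ≡⟨ +-complement c x ⟩
    c % k                            ∎
    where
    open ≡-Reasoning
    swap : ∀ a b c → a + (b + c) ≡ b + a + c
    swap = solve-∀

  offset-unique : ∀ {x c u} → u < k → (x + u) ≈ c → offset x c ≡ u
  offset-unique {x} {c} {u} u<k x+u≈c = begin
    (c + (k ∸ x % k)) % k            ≡⟨ [m%k+n]%k≡[m+n]%k c _ ⟨
    (c % k + (k ∸ x % k)) % k        ≡⟨ cong (λ z → (z + (k ∸ x % k)) % k) x+u≈c ⟨
    ((x + u) % k + (k ∸ x % k)) % k  ≡⟨ [m%k+n]%k≡[m+n]%k (x + u) _ ⟩
    (x + u + (k ∸ x % k)) % k        ≡⟨ cong (λ z → (z + (k ∸ x % k)) % k) (+-comm x u) ⟩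
    (u + x + (k ∸ x % k)) % k        ≡⟨ +-complement u x ⟩
    u % k                            ≡⟨ m<n⇒m%n≡m u<k ⟩
    u                                ∎
    where open ≡-Reasoning

  offset-cong : ∀ {x y} c → x ≈ y → offset x c ≡ offset y c
  offset-cong c x≈y = cong (λ z → (c + (k ∸ z)) % k) x≈y

  offset-congʳ : ∀ x {c d} → c ≈ d → offset x c ≡ offset x d
  offset-congʳ x {c} {d} c≈d = trans (sym ([m%k+n]%k≡[m+n]%k c _))
    (trans (cong (λ z → (z + (k ∸ x % k)) % k) c≈d) ([m%k+n]%k≡[m+n]%k d _))

  offset-cancel : ∀ x {u v} → u < k → v < k → (x + u) ≈ (x + v) → u ≡ v
  offset-cancel x u<k v<k x+u≈x+v = trans (sym (offset-unique u<k x+u≈x+v)) (offset-unique v<k refl)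

  offset-+ : ∀ x {r} → r < k → offset x (x + r) ≡ r
  offset-+ x r<k = offset-unique r<k refl

  offset-self : ∀ x → offset x x ≡ 0
  offset-self x = offset-unique (>-nonZero⁻¹ k) (cong (_% k) (+-identityʳ x))

  offset≡0⇒≈ : ∀ {x c} → offset x c ≡ 0 → x ≈ c
  offset≡0⇒≈ {x} {c} eq =
    trans (cong (_% k) (sym (+-identityʳ x))) (trans (cong (λ z → (x + z) % k) (sym eq)) (offset-spec x c))

  offset-+-≤ : ∀ x {c d} → d ≤ offset x c → offset (x + d) c ≡ offset x c ∸ d
  offset-+-≤ x {c} {d} d≤u = offset-unique (≤-<-trans (m∸n≤m _ d) (offset<k x c))
    (trans (cong (_% k) (trans (+-assoc x d _) (cong (x +_) (m+[n∸m]≡n d≤u)))) (offset-spec x c))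

  offset-+-> : ∀ x {c d} → offset x c < d → d ≤ k → offset (x + d) c ≡ offset x c + (k ∸ d)
  offset-+-> x {c} {d} u<d d≤k = offset-unique bound (begin
    (x + d + (u + (k ∸ d))) % k  ≡⟨ cong (_% k) (swap x d u (k ∸ d)) ⟩
    (x + u + (d + (k ∸ d))) % k  ≡⟨ cong (λ z → (x + u + z) % k) (m+[n∸m]≡n d≤k) ⟩
    (x + u + k) % k              ≡⟨ [m+n]%n≡m%n (x + u) k ⟩
    (x + u) % k                  ≡⟨ offset-spec x c ⟩
    c % k                        ∎)
    where
    open ≡-Reasoning
    u = offset x c
    swap : ∀ a b c e → a + b + (c + e) ≡ a + c + (b + e)
    swap = solve-∀
    bound : u + (k ∸ d) < k
    bound = subst (u + (k ∸ d) <_) (m+[n∸m]≡n d≤k) (+-monoˡ-< (k ∸ d) u<d)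

  -- arc x s c = 1 iff c lies on the arc {x, x + 1, …, x + s - 1} of ℤ/kℤ.
  arc : ℕ → ℕ → ℕ → ℕ
  arc x s c = 𝟙[ offset x c < s ]

  arc-cong : ∀ {x y} s c → x ≈ y → arc x s c ≡ arc y s c
  arc-cong s c x≈y = cong 𝟙[_< s ] (offset-cong c x≈y)

  arc-congʳ : ∀ x s {c d} → c ≈ d → arc x s c ≡ arc x s d
  arc-congʳ x s c≈d = cong 𝟙[_< s ] (offset-congʳ x c≈d)

  arc-start : ∀ x {s} → 1 ≤ s → arc x s x ≡ 1
  arc-start x 1≤s = 𝟙-< (subst (_< _) (sym (offset-self x)) 1≤s)

  arc-+ : ∀ x s {r} → r < k → arc x s (x + r) ≡ 𝟙[ r < s ]
  arc-+ x s r<k = cong 𝟙[_< s ] (offset-+ x r<k)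

  arc-split : ∀ x {d e} c → d + e ≤ k → arc x (d + e) c ≡ arc x d c + arc (x + d) e c
  arc-split x {d} {e} c d+e≤k with <-≤-connex (offset x c) d
  ... | inj₁ u<d = trans (𝟙-< (<-≤-trans u<d (m≤m+n d e))) (sym (cong₂ _+_ (𝟙-< u<d) (𝟙-≥ e≤offset)))
    where
    e≤offset : e ≤ offset (x + d) c
    e≤offset = subst (e ≤_) (sym (offset-+-> x u<d (m+n≤o⇒m≤o d d+e≤k)))
      (≤-trans (m+n≤o⇒m≤o∸n e (subst (_≤ k) (+-comm d e) d+e≤k)) (m≤n+m (k ∸ d) _))
  ... | inj₂ d≤u =
    trans (sym (𝟙-∸ d≤u)) (sym (cong₂ _+_ (𝟙-≥ d≤u) (cong 𝟙[_< e ] (offset-+-≤ x d≤u))))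

  arc-complement : ∀ x {r} c → r ≤ k → arc x r c + arc (x + r) (k ∸ r) c ≡ 1
  arc-complement x {r} c r≤k = trans (sym (arc-split x {r} {k ∸ r} c (≤-reflexive r+[k∸r]≡k)))
    (𝟙-< (subst (offset x c <_) (sym r+[k∸r]≡k) (offset<k x c)))
    where r+[k∸r]≡k = m+[n∸m]≡n r≤k

  arc-injective : ∀ {p p′ s s′} → 1 ≤ s → 1 ≤ s′ → s + s′ ≤ k →
                  (∀ {c} → c < k → arc p s c ≡ arc p′ s′ c) → p ≈ p′ × s ≡ s′
  arc-injective {p} {p′} {s} {s′} 1≤s 1≤s′ s+s′≤k same<k =
    p≈p′ , ≤-antisym (length≤ same p≈p′ s′<k) (length≤ (λ c → sym (same c)) (sym p≈p′) s<k)
    where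
    same : ∀ c → arc p s c ≡ arc p′ s′ c
    same c = trans (arc-congʳ p s (sym (m%k≈m c))) (trans (same<k (m%n<n c k)) (arc-congʳ p′ s′ (m%k≈m c)))
    s<k : s < k
    s<k = <-≤-trans (m<m+n s 1≤s′) s+s′≤k
    s′<k : s′ < k
    s′<k = <-≤-trans (m<n+m s′ 1≤s) s+s′≤k
    -- Two distinct points are at offsets d and k - d from each other, too far apart for both arcs.
    p≈p′ : p ≈ p′
    p≈p′ with offset p p′ ≟ 0
    ... | yes d≡0 = offset≡0⇒≈ d≡0
    ... | no  d≢0 = contradiction s+s′≤k (<⇒≱ (subst (_< s + s′) d+d′≡k (+-mono-< p′∈arc p∈arc′)))
      where
      d = offset p p′
      d≤k = <⇒≤ (offset<k p p′)
      p∈arc′ : offset p′ p < s′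
      p∈arc′ = 𝟙≡1⇒< (trans (sym (same p)) (arc-start p 1≤s))
      p′∈arc : d < s
      p′∈arc = 𝟙≡1⇒< (trans (same p′) (arc-start p′ 1≤s′))
      d+d′≡k : d + offset p′ p ≡ k
      d+d′≡k = begin
        d + offset p′ p             ≡⟨ cong (d +_) (offset-cong p (offset-spec p p′)) ⟨
        d + offset (p + d) p        ≡⟨ cong (d +_) (offset-+-> p (subst (_< d) (sym (offset-self p)) (n≢0⇒n>0 d≢0)) d≤k) ⟩
        d + (offset p p + (k ∸ d))  ≡⟨ cong (λ z → d + (z + (k ∸ d))) (offset-self p) ⟩
        d + (k ∸ d)                 ≡⟨ m+[n∸m]≡n d≤k ⟩
        k                           ∎
        where open ≡-Reasoning
    length≤ : ∀ {q q′ t t′} → (∀ c → arc q t c ≡ arc q′ t′ c) → q ≈ q′ → t′ < k → t ≤ t′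
    length≤ {q} {q′} {t} {t′} same′ q≈q′ t′<k = ≮⇒≥ λ t′<t → 0≢1+n (begin
      0                   ≡⟨ 𝟙-≥ ≤-refl ⟨
      𝟙[ t′ < t′ ]        ≡⟨ arc-+ q t′ t′<k ⟨
      arc q t′ (q + t′)   ≡⟨ arc-cong t′ (q + t′) q≈q′ ⟩
      arc q′ t′ (q + t′)  ≡⟨ same′ (q + t′) ⟨
      arc q t (q + t′)    ≡⟨ arc-+ q t t′<k ⟩
      𝟙[ t′ < t ]         ≡⟨ 𝟙-< t′<t ⟩
      1                   ∎)
      where open ≡-Reasoning

  -- weight m (t q) (t (q + m)) r c = |v|_c for the factor v of length k m at q k + r (count-factor).
  weight : ℕ → ℕ → ℕ → ℕ → ℕ → ℕ
  weight m a b r c = (m + arc b r c) ∸ arc a r c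

  profile : ℕ → ℕ → ℕ → ℕ → List ℕ
  profile m a b r = map (weight m a b r) (upTo k)

  balanced : ℕ → List ℕ
  balanced m = map (λ _ → m) (upTo k)

  weight-cong : ∀ m {a a′ b b′} r c → a ≈ a′ → b ≈ b′ → weight m a b r c ≡ weight m a′ b′ r c
  weight-cong m r c a≈a′ b≈b′ = cong₂ (λ x y → (m + x) ∸ y) (arc-cong r c b≈b′) (arc-cong r c a≈a′)

  weight-empty : ∀ m a b c → weight m a b 0 c ≡ m
  weight-empty m a b c =
    trans (cong₂ (λ x y → (m + x) ∸ y) (𝟙-≥ {offset b c} z≤n) (𝟙-≥ {offset a c} z≤n)) (+-identityʳ m)

  weight-same : ∀ m {a b} r c → a ≈ b → weight m a b r c ≡ m
  weight-same m {b = b} r c a≈b =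
    trans (cong ((m + arc b r c) ∸_) (arc-cong r c a≈b)) (m+n∸n≡m m (arc b r c))

  weight-reflect : ∀ m a b {r} c → r ≤ k → weight m a b r c ≡ weight m (b + r) (a + r) (k ∸ r) c
  weight-reflect m a b {r} c r≤k = ∸-exchange m {arc b r c} {arc (b + r) (k ∸ r) c} {arc a r c}
    (trans (arc-complement b {r} c r≤k) (sym (arc-complement a {r} c r≤k)))

  -- Arcs of length r starting d ≤ r apart share r - d points, which cancel.
  weight-overlap : ∀ m {a b d r} c → a ≈ (b + d) → d ≤ r → r ≤ k →
                   weight m a b r c ≡ weight m (b + r) b d c
  weight-overlap m {a} {b} {d} {r} c a≈b+d d≤r r≤k = begin
    (m + arc b r c) ∸ arc a r c  ≡⟨ cong₂ (λ x y → (m + x) ∸ y) plus minus ⟩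
    (m + (X + Y)) ∸ (Y + Z)      ≡⟨ ∸-exchange m {X + Y} {Z} {Y + Z} {X} (rotate X Y Z) ⟩
    (m + X) ∸ Z                  ∎
    where
    open ≡-Reasoning
    X = arc b d c
    Y = arc (b + d) (r ∸ d) c
    Z = arc (b + r) d c
    rotate : ∀ x y z → x + y + z ≡ y + z + x
    rotate = solve-∀
    d+[r∸d]≡r = m+[n∸m]≡n d≤r
    [r∸d]+d≡r = m∸n+n≡m d≤r
    plus : arc b r c ≡ X + Y
    plus = trans (cong (λ z → arc b z c) (sym d+[r∸d]≡r))
                 (arc-split b {d} {r ∸ d} c (subst (_≤ k) (sym d+[r∸d]≡r) r≤k))
    a+[r∸d]≈b+r : (a + (r ∸ d)) ≈ (b + r)
    a+[r∸d]≈b+r = trans (≈-+ʳ (r ∸ d) a≈b+d) (cong (_% k) (trans (+-assoc b d (r ∸ d)) (cong (b +_) d+[r∸d]≡r)))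
    minus : arc a r c ≡ Y + Z
    minus = begin
      arc a r c                                ≡⟨ cong (λ z → arc a z c) [r∸d]+d≡r ⟨
      arc a ((r ∸ d) + d) c                    ≡⟨ arc-split a {r ∸ d} {d} c (subst (_≤ k) (sym [r∸d]+d≡r) r≤k) ⟩
      arc a (r ∸ d) c + arc (a + (r ∸ d)) d c  ≡⟨ cong₂ _+_ (arc-cong (r ∸ d) c a≈b+d) (arc-cong d c a+[r∸d]≈b+r) ⟩
      Y + Z                                    ∎

  -- The arcs of length s starting at b and at a are nonempty and disjoint.
  record Apart (a b s : ℕ) : Set where
    constructor apart
    field
      1≤s     : 1 ≤ s
      s≤gap   : s ≤ offset b a
      gap+s≤k : offset b a + s ≤ k

  record Reduct (m a b r : ℕ) : Set where
    constructor reduct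
    field
      a′ b′ s      : ℕ
      apart′       : Apart a′ b′ s
      same-weights : ∀ c → weight m a b r c ≡ weight m a′ b′ s c

  reduce-fitting : ∀ m {a b r} → 1 ≤ r → 1 ≤ offset b a → offset b a + r ≤ k → Reduct m a b r
  reduce-fitting m {a} {b} {r} 1≤r 1≤d d+r≤k with r ≤? offset b a
  ... | yes r≤d = reduct a b r (apart 1≤r r≤d d+r≤k) (λ c → refl)
  ... | no  r≰d = reduct (b + r) b d (apart 1≤d d≤offset offset+d≤k)
                    (λ c → weight-overlap m c (sym (offset-spec b a)) (<⇒≤ d<r) (<⇒≤ r<k))
    where
    d = offset b a
    d<r = ≰⇒> r≰d
    r<k : r < k
    r<k = <-≤-trans (m<n+m r 1≤d) d+r≤k
    d≤offset : d ≤ offset b (b + r)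
    d≤offset = subst (d ≤_) (sym (offset-+ b r<k)) (<⇒≤ d<r)
    offset+d≤k : offset b (b + r) + d ≤ k
    offset+d≤k = subst (λ z → z + d ≤ k) (sym (offset-+ b r<k)) (subst (_≤ k) (+-comm d r) d+r≤k)

  -- Replacing both arcs by their complements makes them fit.
  reduce-reflected : ∀ m {a b r} → r < k → 1 ≤ offset b a → k < offset b a + r → Reduct m a b r
  reduce-reflected m {a} {b} {r} r<k 1≤d k<d+r =
    reduct a′ b′ s apart′ (λ c → trans (weight-reflect m a b c (<⇒≤ r<k)) (same-weights c))
    where
    d = offset b a
    d≤k = <⇒≤ (offset<k b a)
    offset-reflected : offset (a + r) (b + r) ≡ k ∸ d
    offset-reflected = offset-unique (∸-monoʳ-< 1≤d d≤k) (begin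
      (a + r + (k ∸ d)) % k        ≡⟨ cong (_% k) (+-assoc a r (k ∸ d)) ⟩
      (a + (r + (k ∸ d))) % k      ≡⟨ ≈-+ʳ (r + (k ∸ d)) (sym (offset-spec b a)) ⟩
      (b + d + (r + (k ∸ d))) % k  ≡⟨ cong (_% k) (swap b d r (k ∸ d)) ⟩
      (b + r + (d + (k ∸ d))) % k  ≡⟨ cong (λ z → (b + r + z) % k) (m+[n∸m]≡n d≤k) ⟩
      (b + r + k) % k              ≡⟨ [m+n]%n≡m%n (b + r) k ⟩
      (b + r) % k                  ∎)
      where
      open ≡-Reasoning
      swap : ∀ a b c e → a + b + (c + e) ≡ a + c + (b + e)
      swap = solve-∀
    k∸r<d : k ∸ r < d
    k∸r<d = +-cancelʳ-< r (k ∸ r) d (subst (_< d + r) (sym (m∸n+n≡m (<⇒≤ r<k))) k<d+r)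
    fits : offset (a + r) (b + r) + (k ∸ r) ≤ k
    fits = subst (λ z → z + (k ∸ r) ≤ k) (sym offset-reflected)
             (<⇒≤ (subst (k ∸ d + (k ∸ r) <_) (m∸n+n≡m d≤k) (+-monoʳ-< (k ∸ d) k∸r<d)))
    open Reduct (reduce-fitting m {b + r} {a + r} (m<n⇒0<n∸m r<k)
                  (subst (1 ≤_) (sym offset-reflected) (m<n⇒0<n∸m (offset<k b a))) fits)

  classify : ∀ m a b {r} → r < k → (∀ c → weight m a b r c ≡ m) ⊎ Reduct m a b r
  classify m a b {zero}  _ = inj₁ (weight-empty m a b)
  classify m a b {suc r} r<k with offset b a ≟ 0
  ... | yes d≡0 = inj₁ (λ c → weight-same m (suc r) c (sym (offset≡0⇒≈ d≡0)))
  ... | no  d≢0 with offset b a + suc r ≤? k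
  ...   | yes fits  = inj₂ (reduce-fitting m z<s (n≢0⇒n>0 d≢0) fits)
  ...   | no  ¬fits = inj₂ (reduce-reflected m r<k (n≢0⇒n>0 d≢0) (≰⇒> ¬fits))

  apart-2s≤k : ∀ {a b s} → Apart a b s → s + s ≤ k
  apart-2s≤k (apart _ s≤d d+s≤k) = ≤-trans (+-monoˡ-≤ _ s≤d) d+s≤k

  apart-disjoint : ∀ {a b s} c → Apart a b s → arc b s c ≡ 1 → arc a s c ≡ 0
  apart-disjoint {a} {b} {s} c (apart _ s≤d d+s≤k) c∈arc = 𝟙-≥ (subst (s ≤_) (sym offset-a) s≤offset)
    where
    d = offset b a
    u<d : offset b c < d
    u<d = <-≤-trans (𝟙≡1⇒< c∈arc) s≤d
    offset-a : offset a c ≡ offset b c + (k ∸ d)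
    offset-a = trans (offset-cong c (sym (offset-spec b a))) (offset-+-> b u<d (<⇒≤ (offset<k b a)))
    s≤offset : s ≤ offset b c + (k ∸ d)
    s≤offset = ≤-trans (m+n≤o⇒m≤o∸n s (subst (_≤ k) (+-comm d s) d+s≤k)) (m≤n+m (k ∸ d) _)

  weight-decode : ∀ {m a b s} c → 1 ≤ m → Apart a b s →
                  weight m a b s c ∸ m ≡ arc b s c × m ∸ weight m a b s c ≡ arc a s c
  weight-decode {a = a} {b} {s} c 1≤m ab =
    ∸-decode 1≤m (𝟙≤1 (offset b c) s) (𝟙≤1 (offset a c) s) (apart-disjoint c ab)

  profile-injective : ∀ {m a b s a′ b′ s′} → 1 ≤ m → Apart a b s → Apart a′ b′ s′ →
                      profile m a b s ≡ profile m a′ b′ s′ → a ≈ a′ × b ≈ b′ × s ≡ s′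
  profile-injective {m} {a} {b} {s} {a′} {b′} {s′} 1≤m ab ab′ eq =
    proj₁ (arc-injective 1≤s 1≤s′ s+s′≤k minus) , arc-injective 1≤s 1≤s′ s+s′≤k plus
    where
    1≤s = Apart.1≤s ab
    1≤s′ = Apart.1≤s ab′
    s+s′≤k : s + s′ ≤ k
    s+s′≤k with ≤-total s s′
    ... | inj₁ s≤s′ = ≤-trans (+-monoˡ-≤ s′ s≤s′) (apart-2s≤k ab′)
    ... | inj₂ s′≤s = ≤-trans (+-monoʳ-≤ s s′≤s) (apart-2s≤k ab)
    same : ∀ {c} → c < k → weight m a b s c ≡ weight m a′ b′ s′ c
    same = map-upTo-cong⁻ (weight m a b s) (weight m a′ b′ s′) eq
    plus : ∀ {c} → c < k → arc b s c ≡ arc b′ s′ c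
    plus {c} c<k = trans (sym (proj₁ (weight-decode c 1≤m ab)))
                     (trans (cong (_∸ m) (same c<k)) (proj₁ (weight-decode c 1≤m ab′)))
    minus : ∀ {c} → c < k → arc a s c ≡ arc a′ s′ c
    minus {c} c<k = trans (sym (proj₂ (weight-decode c 1≤m ab)))
                      (trans (cong (m ∸_) (same c<k)) (proj₂ (weight-decode c 1≤m ab′)))

  apart-≢-balanced : ∀ {m a b s} → Apart a b s → profile m a b s ≢ balanced m
  apart-≢-balanced {m} {a} {b} {s} ab eq = m+1+n≢m m (begin
    m + 1                   ≡⟨ cong₂ (λ x y → (m + x) ∸ y) b∈arc (apart-disjoint b ab b∈arc) ⟨
    weight m a b s b        ≡⟨ cong₂ (λ x y → (m + x) ∸ y) (arc-congʳ b s (m%k≈m b)) (arc-congʳ a s (m%k≈m b)) ⟨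
    weight m a b s (b % k)  ≡⟨ map-upTo-cong⁻ (weight m a b s) (λ _ → m) eq (m%n<n b k) ⟩
    m                       ∎)
    where
    open ≡-Reasoning
    b∈arc = arc-start b (Apart.1≤s ab)

  gaps : ℕ → ℕ
  gaps s′ = k + 1 ∸ 2 * suc s′

  Index : Set
  Index = ℕ × ℕ × ℕ

  -- (s′ , p , e) stands for the arcs of length s = 1 + s′ starting at p and at p + s + e.
  row : ℕ → ℕ → List Index
  row s′ p = map (λ e → s′ , p , e) (upTo (gaps s′))

  block : ℕ → List Index
  block s′ = concatMap (row s′) (upTo k)

  indices : List Index
  indices = concatMap block (upTo (k / 2))

  Valid : Index → Set
  Valid (s′ , p , e) = s′ < k / 2 × p < k × e < gaps s′

  profileAt : ℕ → Index → List ℕ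
  profileAt m (s′ , p , e) = profile m (p + suc s′ + e) p (suc s′)

  profiles : ℕ → List (List ℕ)
  profiles m = balanced m ∷ map (profileAt m) indices

  <half⇔ : ∀ {s′} → s′ < k / 2 ⇔ 2 * suc s′ ≤ k
  <half⇔ {s′} = mk⇔
    (λ s′<half → ≤-trans (≤-reflexive (*-comm 2 (suc s′))) (≤-trans (*-monoˡ-≤ 2 s′<half) (m/n*n≤m k 2)))
    (λ 2s≤k → subst (_≤ k / 2) (m*n/n≡m (suc s′) 2) (/-monoˡ-≤ 2 (subst (_≤ k) (*-comm 2 (suc s′)) 2s≤k)))

  gaps≢0 : ∀ {s′ e} → e < gaps s′ → gaps s′ ≢ 0
  gaps≢0 {e = e} e<gaps gaps≡0 = n≮0 (subst (e <_) gaps≡0 e<gaps)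

  <gaps⇔ : ∀ {s′ e} → e < gaps s′ ⇔ e + 2 * suc s′ ≤ k
  <gaps⇔ {s′} {e} = mk⇔
    (λ e<gaps → s≤s⁻¹ (subst (suc e + 2 * suc s′ ≤_) (+-comm k 1)
                         (m≤o∸n⇒m+n≤o (suc e) (<⇒≤ (m∸n≢0⇒n<m (gaps≢0 e<gaps))) e<gaps)))
    (λ fits → m+n≤o⇒m≤o∸n (suc e) (subst (suc (e + 2 * suc s′) ≤_) (+-comm 1 k) (s≤s fits)))

  ∈-indices⁻ : ∀ {x} → x ∈ indices → Valid x
  ∈-indices⁻ x∈ with find (∈-concatMap⁻ block {xs = upTo (k / 2)} x∈)
  ... | s′ , s′∈ , x∈block with find (∈-concatMap⁻ (row s′) {xs = upTo k} x∈block)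
  ... | p , p∈ , x∈row with ∈-map⁻ (λ e → s′ , p , e) x∈row
  ... | e , e∈ , refl = ∈-upTo⁻ s′∈ , ∈-upTo⁻ p∈ , ∈-upTo⁻ e∈

  ∈-indices⁺ : ∀ {x} → Valid x → x ∈ indices
  ∈-indices⁺ {s′ , p , e} (s′< , p<k , e<) = ∈-concatMap⁺ block (lose (∈-upTo⁺ s′<)
    (∈-concatMap⁺ (row s′) (lose (∈-upTo⁺ p<k) (∈-map⁺ (λ e → s′ , p , e) (∈-upTo⁺ e<)))))

  indices-unique : Unique indices
  indices-unique = Unique-concatMap⁺ block proj₁ tag-s′
    (λ s′ → Unique-concatMap⁺ (row s′) (proj₁ ∘ proj₂) tag-p
      (λ p → Unique.map⁺ (cong (proj₂ ∘ proj₂)) (Unique.upTo⁺ _)) (Unique.upTo⁺ k))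
    (Unique.upTo⁺ (k / 2))
    where
    tag-p : ∀ {s′ p} {x : Index} → x ∈ row s′ p → proj₁ (proj₂ x) ≡ p
    tag-p x∈ with ∈-map⁻ _ x∈
    ... | e , _ , refl = refl
    tag-s′ : ∀ {s′} {x : Index} → x ∈ block s′ → proj₁ x ≡ s′
    tag-s′ {s′} x∈ with find (∈-concatMap⁻ (row s′) {xs = upTo k} x∈)
    ... | p , _ , x∈row with ∈-map⁻ _ x∈row
    ... | e , _ , refl = refl

  valid⇒apart : ∀ {s′ p e} → Valid (s′ , p , e) → Apart (p + suc s′ + e) p (suc s′)
  valid⇒apart {s′} {p} {e} (_ , _ , e<gaps) =
    apart z<s (subst (s ≤_) (sym offset≡s+e) (m≤m+n s e)) (subst (λ z → z + s ≤ k) (sym offset≡s+e) s+e+s≤k)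
    where
    s = suc s′
    rearrange : ∀ e s → e + 2 * s ≡ s + e + s
    rearrange = solve-∀
    s+e+s≤k : s + e + s ≤ k
    s+e+s≤k = subst (_≤ k) (rearrange e s) (Equivalence.to <gaps⇔ e<gaps)
    offset≡s+e : offset p (p + s + e) ≡ s + e
    offset≡s+e = trans (cong (offset p) (+-assoc p s e)) (offset-+ p (<-≤-trans (m<m+n (s + e) z<s) s+e+s≤k))

  valid⇒e<k : ∀ {s′ p e} → Valid (s′ , p , e) → e < k
  valid⇒e<k {e = e} (_ , _ , e<gaps) = <-≤-trans (m<m+n e z<s) (Equivalence.to <gaps⇔ e<gaps)

  apart⇒∈ : ∀ m {a b s} → Apart a b s → profile m a b s ∈ profiles m
  apart⇒∈ m {a} {b} {suc s′} (apart _ s≤d d+s≤k) =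
    there (subst (_∈ map (profileAt m) indices) same-profile (∈-map⁺ (profileAt m) (∈-indices⁺ valid)))
    where
    s = suc s′
    d = offset b a
    e = d ∸ s
    twice : ∀ e s → e + 2 * s ≡ e + s + s
    twice = solve-∀
    e+2s≤k : e + 2 * s ≤ k
    e+2s≤k = subst (_≤ k) (sym (trans (twice e s) (cong (_+ s) (m∸n+n≡m s≤d)))) d+s≤k
    valid : Valid (s′ , b % k , e)
    valid = Equivalence.from <half⇔ (≤-trans (m≤n+m (2 * s) e) e+2s≤k) , m%n<n b k ,
            Equivalence.from <gaps⇔ e+2s≤k
    start≈a : (b % k + s + e) ≈ a
    start≈a = begin
      (b % k + s + e) % k  ≡⟨ cong (_% k) (trans (+-assoc (b % k) s e) (cong (b % k +_) (m+[n∸m]≡n s≤d))) ⟩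
      (b % k + d) % k      ≡⟨ [m%k+n]%k≡[m+n]%k b d ⟩
      (b + d) % k          ≡⟨ offset-spec b a ⟩
      a % k                ∎
      where open ≡-Reasoning
    same-profile : profileAt m (s′ , b % k , e) ≡ profile m a b s
    same-profile = map-cong (λ c → weight-cong m s c start≈a (m%k≈m b)) (upTo k)

  profileAt-injective : ∀ m {x y} → 1 ≤ m → Valid x → Valid y → profileAt m x ≡ profileAt m y → x ≡ y
  profileAt-injective m {s′ , p , e} {t′ , q , f} 1≤m vx@(_ , p<k , _) vy@(_ , q<k , _) eq
    with profile-injective 1≤m (valid⇒apart vx) (valid⇒apart vy) eq
  ... | start≈ , p≈q , s≡t with ≈⇒≡ p<k q<k p≈q | suc-injective s≡t
  ... | refl | refl =
    cong (λ z → s′ , p , z) (offset-cancel (p + suc s′) (valid⇒e<k vx) (valid⇒e<k vy) start≈)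

  profiles-unique : ∀ {m} → 1 ≤ m → Unique (profiles m)
  profiles-unique {m} 1≤m = All.tabulate balanced-fresh
    ∷ Unique-map⁺-on (profileAt m) (profileAt-injective m 1≤m) (All.tabulate ∈-indices⁻) indices-unique
    where
    balanced-fresh : ∀ {v} → v ∈ map (profileAt m) indices → balanced m ≢ v
    balanced-fresh v∈ with ∈-map⁻ (profileAt m) v∈
    ... | x , x∈ , refl = apart-≢-balanced (valid⇒apart (∈-indices⁻ x∈)) ∘ sym

  length-profiles : ∀ m → length (profiles m) ≡ 1 + sum (map (λ s → k * (k + 1 ∸ 2 * suc s)) (upTo (k / 2)))
  length-profiles m = cong suc (trans (length-map (profileAt m) indices)
    (trans (length-concatMap block (upTo (k / 2))) (cong sum (map-cong length-block (upTo (k / 2))))))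
    where
    length-block : ∀ s′ → length (block s′) ≡ k * gaps s′
    length-block s′ = begin
      length (block s′)                                ≡⟨ length-concatMap (row s′) (upTo k) ⟩
      sum (map (λ p → length (row s′ p)) (upTo k))     ≡⟨ cong sum (map-cong length-row (upTo k)) ⟩
      sum (map (λ _ → gaps s′) (upTo k))               ≡⟨ sum-map-const (gaps s′) (upTo k) ⟩
      length (upTo k) * gaps s′                        ≡⟨ cong (_* gaps s′) (length-upTo k) ⟩
      k * gaps s′                                      ∎
      where
      open ≡-Reasoning
      length-row : ∀ p → length (row s′ p) ≡ gaps s′
      length-row p = trans (length-map (λ e → s′ , p , e) (upTo (gaps s′))) (length-upTo (gaps s′))

-- The fixed point t^(k)

module FixedPoint (j : ℕ) where

  k : ℕ
  k = 2 + j

  open Cyclic k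

  addMod≡% : ∀ {a b} → a < k → b < k → addMod k a b ≡ (a + b) % k
  addMod≡% {a} {b} a<k b<k with (a + b) <ᵇ k in eq
  ... | true  = sym (m<n⇒m%n≡m (<ᵇ⇒< (a + b) k (subst T (sym eq) tt)))
  ... | false = trans (sym (m<n⇒m%n≡m (m<n+o⇒m∸n<o (a + b) k (+-mono-< a<k b<k)))) (m≤n⇒[n∸m]%m≡n%m k≤a+b)
    where
    k≤a+b : k ≤ a + b
    k≤a+b = ≮⇒≥ (λ a+b<k → subst T eq (<⇒<ᵇ a+b<k))

  length-σ : ∀ x → length (σ k x) ≡ k
  length-σ x = trans (length-map (addMod k x) (upTo k)) (length-upTo k)

  length-σ* : ∀ w → length (σ* k w) ≡ length w * k
  length-σ* []      = refl
  length-σ* (x ∷ w) = trans (length-++ (σ k x)) (cong₂ _+_ (length-σ x) (length-σ* w))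

  length-σ^ : ∀ n → length (σ^ k n) ≡ k ^ n
  length-σ^ zero    = refl
  length-σ^ (suc n) = trans (length-σ* (σ^ k n)) (trans (cong (_* k) (length-σ^ n)) (*-comm (k ^ n) k))

  σ^-letters : ∀ n → All (_< k) (σ^ k n)
  σ^-letters zero    = z<s ∷ []
  σ^-letters (suc n) = σ*-letters (σ^-letters n)
    where
    letter : ∀ {x r} → x < k → r < k → addMod k x r < k
    letter {x} {r} x<k r<k = subst (_< k) (sym (addMod≡% x<k r<k)) (m%n<n (x + r) k)
    σ*-letters : ∀ {w} → All (_< k) w → All (_< k) (σ* k w)
    σ*-letters []          = []
    σ*-letters (x<k ∷ w<k) =
      All.++⁺ (All.map⁺ (All.tabulate (λ r∈ → letter x<k (∈-upTo⁻ r∈)))) (σ*-letters w<k)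

  σ^-prefix : ∀ n → ∃ λ rest → σ^ k (suc n) ≡ σ^ k n ++ rest
  σ^-prefix zero    = _ , refl
  σ^-prefix (suc n) with σ^-prefix n
  ... | rest , eq = σ* k rest , trans (cong (σ* k) eq) (concatMap-++ (σ k) (σ^ k n) rest)

  nth-σ* : ∀ w {q r} → q < length w → r < k → nth (σ* k w) (q * k + r) ≡ addMod k (nth w q) r
  nth-σ* (x ∷ w) {zero}  {r} _ r<k =
    trans (nth-++ˡ (σ k x) (σ* k w) (subst (r <_) (sym (length-σ x)) r<k)) (nth-map-upTo (addMod k x) r<k)
  nth-σ* (x ∷ w) {suc q} {r} (s≤s q<n) r<k = begin
    nth (σ k x ++ σ* k w) (k + q * k + r)                 ≡⟨ cong (nth (σ k x ++ σ* k w)) (+-assoc k (q * k) r) ⟩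
    nth (σ k x ++ σ* k w) (k + (q * k + r))               ≡⟨ cong (λ z → nth (σ k x ++ σ* k w) (z + (q * k + r)))
                                                                (length-σ x) ⟨
    nth (σ k x ++ σ* k w) (length (σ k x) + (q * k + r))  ≡⟨ nth-++ʳ (σ k x) (σ* k w) (q * k + r) ⟩
    nth (σ* k w) (q * k + r)                              ≡⟨ nth-σ* w q<n r<k ⟩
    addMod k (nth w q) r                                  ∎
    where open ≡-Reasoning

  nth-σ^-+ : ∀ d {n i} → i < k ^ n → nth (σ^ k (d + n)) i ≡ nth (σ^ k n) i
  nth-σ^-+ zero    i<k^n = refl
  nth-σ^-+ (suc d) {n} {i} i<k^n with σ^-prefix (d + n)
  ... | rest , eq = trans (cong (λ l → nth l i) eq) (trans (nth-++ˡ (σ^ k (d + n)) rest i<length) (nth-σ^-+ d i<k^n))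
    where
    i<length : i < length (σ^ k (d + n))
    i<length = subst (i <_) (sym (length-σ^ (d + n))) (<-≤-trans i<k^n (^-monoʳ-≤ k (m≤n+m n d)))

  n<k^n : ∀ n → n < k ^ n
  n<k^n zero    = z<s
  n<k^n (suc n) = subst (_≤ k ^ suc n) (+-comm (suc n) 1)
    (+-mono-≤ (n<k^n n) (≤-trans (<-≤-trans z<s (n<k^n n)) (m≤m+n (k ^ n) (j * k ^ n))))

  n<k^[1+n] : ∀ n → n < k ^ suc n
  n<k^[1+n] n = <-≤-trans (n<k^n n) (^-monoʳ-≤ k (n≤1+n n))

  t-nth : ∀ n {i} → i < k ^ n → t k i ≡ nth (σ^ k n) i
  t-nth n {i} i<k^n with ≤-total (suc i) n
  ... | inj₁ 1+i≤n =
    sym (trans (cong (λ z → nth (σ^ k z) i) (sym (m∸n+n≡m 1+i≤n))) (nth-σ^-+ (n ∸ suc i) (n<k^[1+n] i)))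
  ... | inj₂ n≤1+i = trans (cong (λ z → nth (σ^ k z) i) (sym (m∸n+n≡m n≤1+i))) (nth-σ^-+ (suc i ∸ n) i<k^n)

  t<k : ∀ i → t k i < k
  t<k i = nth-All (subst (i <_) (sym (length-σ^ (suc i))) (n<k^[1+n] i)) (σ^-letters (suc i))

  q*k+r<k^[2+q] : ∀ q {r} → r < k → q * k + r < k ^ suc (suc q)
  q*k+r<k^[2+q] q {r} r<k = begin-strict
    q * k + r        <⟨ +-monoʳ-< (q * k) r<k ⟩
    q * k + k        ≡⟨ +-comm (q * k) k ⟩
    suc q * k        ≤⟨ *-monoˡ-≤ k (<⇒≤ (n<k^n (suc q))) ⟩
    k ^ suc q * k    ≡⟨ *-comm (k ^ suc q) k ⟩
    k ^ suc (suc q)  ∎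
    where open ≤-Reasoning

  t-digit : ∀ q {r} → r < k → t k (q * k + r) ≡ (t k q + r) % k
  t-digit q {r} r<k = begin
    t k (q * k + r)                        ≡⟨ t-nth (suc (suc q)) (q*k+r<k^[2+q] q r<k) ⟩
    nth (σ* k (σ^ k (suc q))) (q * k + r)  ≡⟨ nth-σ* (σ^ k (suc q)) q<length r<k ⟩
    addMod k (nth (σ^ k (suc q)) q) r      ≡⟨ cong (λ z → addMod k z r) (t-nth (suc q) (n<k^[1+n] q)) ⟨
    addMod k (t k q) r                     ≡⟨ addMod≡% (t<k q) r<k ⟩
    (t k q + r) % k                        ∎
    where
    open ≡-Reasoning
    q<length = subst (q <_) (sym (length-σ^ (suc q))) (n<k^[1+n] q)

  t-small : ∀ {r} → r < k → t k r ≡ r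
  t-small r<k = trans (t-digit 0 r<k) (m<n⇒m%n≡m r<k)

  t-+ : ∀ L x {z} → z < k ^ L → t k (x * k ^ L + z) ≡ (t k x + t k z) % k
  t-+ zero x {zero} _ = begin
    t k (x * 1 + 0)  ≡⟨ cong (t k) (trans (+-identityʳ (x * 1)) (*-identityʳ x)) ⟩
    t k x            ≡⟨ m<n⇒m%n≡m (t<k x) ⟨
    t k x % k        ≡⟨ cong (_% k) (+-identityʳ (t k x)) ⟨
    (t k x + 0) % k  ∎
    where open ≡-Reasoning
  t-+ zero x {suc z} (s≤s ())
  t-+ (suc L) x {z} z<k^[1+L] = begin
    t k (x * (k * k ^ L) + z)              ≡⟨ cong (λ w → t k (x * (k * k ^ L) + w)) z≡ ⟩
    t k (x * (k * k ^ L) + (z₁ * k + z₀))  ≡⟨ cong (t k) (regroup x (k ^ L) k z₁ z₀) ⟩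
    t k ((x * k ^ L + z₁) * k + z₀)        ≡⟨ t-digit (x * k ^ L + z₁) z₀<k ⟩
    (t k (x * k ^ L + z₁) + z₀) % k        ≡⟨ cong (λ w → (w + z₀) % k) (t-+ L x z₁<k^L) ⟩
    ((t k x + t k z₁) % k + z₀) % k        ≡⟨ [m%k+n]%k≡[m+n]%k (t k x + t k z₁) z₀ ⟩
    (t k x + t k z₁ + z₀) % k              ≡⟨ cong (_% k) (+-assoc (t k x) (t k z₁) z₀) ⟩
    (t k x + (t k z₁ + z₀)) % k            ≡⟨ [m+n%k]%k≡[m+n]%k (t k x) (t k z₁ + z₀) ⟨
    (t k x + (t k z₁ + z₀) % k) % k        ≡⟨ cong (λ w → (t k x + w) % k) (t-digit z₁ z₀<k) ⟨
    (t k x + t k (z₁ * k + z₀)) % k        ≡⟨ cong (λ w → (t k x + t k w) % k) z≡ ⟨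
    (t k x + t k z) % k                    ∎
    where
    open ≡-Reasoning
    z₀ = z % k
    z₁ = z / k
    z≡ : z ≡ z₁ * k + z₀
    z≡ = trans (m≡m%n+[m/n]*n z k) (+-comm z₀ (z₁ * k))
    z₀<k = m%n<n z k
    z₁<k^L : z₁ < k ^ L
    z₁<k^L = m<n*o⇒m/o<n (subst (z <_) (*-comm k (k ^ L)) z<k^[1+L])
    regroup : ∀ x K k z₁ z₀ → x * (k * K) + (z₁ * k + z₀) ≡ (x * K + z₁) * k + z₀
    regroup = solve-∀

  t-^ : ∀ L → t k (k ^ L) ≡ 1
  t-^ L = begin
    t k (k ^ L)          ≡⟨ cong (t k) (trans (+-identityʳ (1 * k ^ L)) (*-identityˡ (k ^ L))) ⟨
    t k (1 * k ^ L + 0)  ≡⟨ t-+ L 1 (<-≤-trans z<s (n<k^n L)) ⟩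
    (t k 1 + 0) % k      ≡⟨ cong (λ z → (z + 0) % k) (t-small 1<k) ⟩
    1 % k                ≡⟨ m<n⇒m%n≡m 1<k ⟩
    1                    ∎
    where
    open ≡-Reasoning
    1<k : 1 < k
    1<k = s≤s (s≤s z≤n)

  -- Going from w m e to w m (1 + e) prepends the digit k - 1, so t decreases by one (mod k).
  w : ℕ → ℕ → ℕ
  w m e = k ^ (m + e) ∸ m

  m≤k^[m+e] : ∀ m e → m ≤ k ^ (m + e)
  m≤k^[m+e] m e = ≤-trans (<⇒≤ (n<k^n m)) (^-monoʳ-≤ k (m≤m+n m e))

  w<k^[m+e] : ∀ {m} e → 1 ≤ m → w m e < k ^ (m + e)
  w<k^[m+e] {m} e 1≤m = subst (w m e <_) (m∸n+n≡m (m≤k^[m+e] m e)) (m<m+n (w m e) 1≤m)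

  k^[m+e]<k^[m+1+e] : ∀ m e → k ^ (m + e) < k ^ (m + suc e)
  k^[m+e]<k^[m+1+e] m e = subst (k ^ (m + e) <_) (cong (k ^_) (sym (+-suc m e)))
    (m<m+n (k ^ (m + e)) (<-≤-trans z<s (≤-trans (n<k^n (m + e)) (m≤m+n (k ^ (m + e)) (j * k ^ (m + e))))))

  w-suc : ∀ m e → w m (suc e) ≡ suc j * k ^ (m + e) + w m e
  w-suc m e = begin
    k ^ (m + suc e) ∸ m                      ≡⟨ cong (λ z → k ^ z ∸ m) (+-suc m e) ⟩
    (k ^ (m + e) + suc j * k ^ (m + e)) ∸ m  ≡⟨ cong (_∸ m) (+-comm (k ^ (m + e)) _) ⟩
    (suc j * k ^ (m + e) + k ^ (m + e)) ∸ m  ≡⟨ +-∸-assoc (suc j * k ^ (m + e)) (m≤k^[m+e] m e) ⟩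
    suc j * k ^ (m + e) + w m e              ∎
    where open ≡-Reasoning

  t-w-drift : ∀ {m} e → 1 ≤ m → (t k (w m e) + e) ≈ t k (w m 0)
  t-w-drift {m} zero    _   = cong (_% k) (+-identityʳ (t k (w m 0)))
  t-w-drift {m} (suc e) 1≤m = begin
    (t k (w m (suc e)) + suc e) % k                    ≡⟨ cong (λ z → (t k z + suc e) % k) (w-suc m e) ⟩
    (t k (suc j * k ^ (m + e) + w m e) + suc e) % k    ≡⟨ cong (λ z → (z + suc e) % k)
                                                            (t-+ (m + e) (suc j) (w<k^[m+e] e 1≤m)) ⟩
    ((t k (suc j) + t k (w m e)) % k + suc e) % k      ≡⟨ [m%k+n]%k≡[m+n]%k (t k (suc j) + t k (w m e)) (suc e) ⟩
    (t k (suc j) + t k (w m e) + suc e) % k            ≡⟨ cong (λ z → (z + t k (w m e) + suc e) % k) (t-small ≤-refl) ⟩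
    (suc j + t k (w m e) + suc e) % k                  ≡⟨ cong (_% k) (rearrange j (t k (w m e)) e) ⟩
    (t k (w m e) + e + k) % k                          ≡⟨ [m+n]%n≡m%n (t k (w m e) + e) k ⟩
    (t k (w m e) + e) % k                              ≡⟨ t-w-drift e 1≤m ⟩
    t k (w m 0) % k                                    ∎
    where
    open ≡-Reasoning
    rearrange : ∀ j t e → suc j + t + suc e ≡ t + e + suc (suc j)
    rearrange = solve-∀

  t-w-onto : ∀ {m g} → 1 ≤ m → g < k → ∃ λ e → t k (w m e) ≡ g
  t-w-onto {m} {g} 1≤m g<k = e , sym (offset-cancel e g<k (t<k (w m e)) (begin
    (e + g) % k            ≡⟨ cong (_% k) (+-comm e g) ⟩
    (g + e) % k            ≡⟨ offset-spec g (t k (w m 0)) ⟩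
    t k (w m 0) % k        ≡⟨ t-w-drift e 1≤m ⟨
    (t k (w m e) + e) % k  ≡⟨ cong (_% k) (+-comm (t k (w m e)) e) ⟩
    (e + t k (w m e)) % k  ∎))
    where
    open ≡-Reasoning
    e = offset g (t k (w m 0))

  -- q = y k^(m+e+1) + w m e has t q = y + t (w m e) and t (q + m) = t (y k^(m+e+1) + k^(m+e)) = y + 1.
  realise : ∀ {m a b} → 1 ≤ m → a < k → b < k → ∃ λ q → t k q ≡ a × t k (q + m) ≡ b
  realise {m} {a} {b} 1≤m a<k b<k = q , t-q , t-q+m
    where
    y = offset 1 b
    y<k = offset<k 1 b
    onto = t-w-onto 1≤m (offset<k y a)
    e = proj₁ onto
    L = m + suc e
    q = y * k ^ L + w m e
    open ≡-Reasoning
    t-q : t k q ≡ a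
    t-q = begin
      t k (y * k ^ L + w m e)    ≡⟨ t-+ L y (<-trans (w<k^[m+e] e 1≤m) (k^[m+e]<k^[m+1+e] m e)) ⟩
      (t k y + t k (w m e)) % k  ≡⟨ cong₂ (λ u v → (u + v) % k) (t-small y<k) (proj₂ onto) ⟩
      (y + offset y a) % k       ≡⟨ offset-spec y a ⟩
      a % k                      ≡⟨ m<n⇒m%n≡m a<k ⟩
      a                          ∎
    t-q+m : t k (q + m) ≡ b
    t-q+m = begin
      t k (y * k ^ L + w m e + m)      ≡⟨ cong (t k) (trans (+-assoc (y * k ^ L) (w m e) m)
                                                      (cong (y * k ^ L +_) (m∸n+n≡m (m≤k^[m+e] m e)))) ⟩
      t k (y * k ^ L + k ^ (m + e))    ≡⟨ t-+ L y (k^[m+e]<k^[m+1+e] m e) ⟩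
      (t k y + t k (k ^ (m + e))) % k  ≡⟨ cong₂ (λ u v → (u + v) % k) (t-small y<k) (t-^ (m + e)) ⟩
      (y + 1) % k                      ≡⟨ cong (_% k) (+-comm y 1) ⟩
      (1 + offset 1 b) % k             ≡⟨ offset-spec 1 b ⟩
      b % k                            ≡⟨ m<n⇒m%n≡m b<k ⟩
      b                                ∎

  segment : ℕ → ℕ → List ℕ
  segment i zero    = []
  segment i (suc n) = t k i ∷ segment (suc i) n

  factor≡segment : ∀ i n → factor k i n ≡ segment i n
  factor≡segment i n = trans (map-upTo _ n) (applyUpTo≡segment i n (λ x → refl))
    where
    applyUpTo≡segment : ∀ i n {f : ℕ → ℕ} → (∀ x → f x ≡ t k (i + x)) → applyUpTo f n ≡ segment i n
    applyUpTo≡segment i zero    f≗ = refl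
    applyUpTo≡segment i (suc n) f≗ = cong₂ _∷_ (trans (f≗ 0) (cong (t k) (+-identityʳ i)))
      (applyUpTo≡segment (suc i) n (λ x → trans (f≗ (suc x)) (cong (t k) (+-suc i x))))

  segment-++ : ∀ i a b → segment i (a + b) ≡ segment i a ++ segment (i + a) b
  segment-++ i zero    b = cong (λ z → segment z b) (sym (+-identityʳ i))
  segment-++ i (suc a) b = cong (t k i ∷_)
    (trans (segment-++ (suc i) a b) (cong (λ z → segment (suc i) a ++ segment z b) (sym (+-suc i a))))

  segment-∷ʳ : ∀ i n → segment i (suc n) ≡ segment i n ++ t k (i + n) ∷ []
  segment-∷ʳ i n = trans (cong (segment i) (+-comm 1 n)) (segment-++ i n 1)

  count-segment-arc : ∀ q {r c} → r ≤ k → c < k → count c (segment (q * k) r) ≡ arc (t k q) r c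
  count-segment-arc q {zero}  {c} _ _ = sym (𝟙-≥ {offset (t k q) c} z≤n)
  count-segment-arc q {suc r} {c} r<k c<k = begin
    count c (segment (q * k) (suc r))                    ≡⟨ cong (count c) (segment-∷ʳ (q * k) r) ⟩
    count c (segment (q * k) r ++ x ∷ [])                ≡⟨ count-++ c (segment (q * k) r) (x ∷ []) ⟩
    count c (segment (q * k) r) + count c (x ∷ [])       ≡⟨ cong₂ _+_ (count-segment-arc q (<⇒≤ r<k) c<k)
                                                                       (count-∷-cong x≡c⇒r≡u r≡u⇒x≡c) ⟩
    arc (t k q) r c + count (offset (t k q) c) (r ∷ [])  ≡⟨ 𝟙-suc (offset (t k q) c) r ⟨
    arc (t k q) (suc r) c                                ∎
    where
    open ≡-Reasoning
    x = t k (q * k + r)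
    x≡ : x ≡ (t k q + r) % k
    x≡ = t-digit q r<k
    x≡c⇒r≡u : x ≡ c → r ≡ offset (t k q) c
    x≡c⇒r≡u x≡c = sym (offset-unique {t k q} {c} r<k (trans (sym x≡) (trans x≡c (sym (m<n⇒m%n≡m c<k)))))
    r≡u⇒x≡c : r ≡ offset (t k q) c → x ≡ c
    r≡u⇒x≡c r≡u =
      trans x≡ (trans (cong (λ z → (t k q + z) % k) r≡u) (trans (offset-spec (t k q) c) (m<n⇒m%n≡m c<k)))

  count-segment-blocks : ∀ q n {c} → c < k → count c (segment (q * k) (n * k)) ≡ n
  count-segment-blocks q zero    _   = refl
  count-segment-blocks q (suc n) {c} c<k = begin
    count c (segment (q * k) (k + n * k))                                ≡⟨ cong (count c) (segment-++ (q * k) k (n * k)) ⟩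
    count c (segment (q * k) k ++ segment (q * k + k) (n * k))           ≡⟨ count-++ c (segment (q * k) k) _ ⟩
    count c (segment (q * k) k) + count c (segment (q * k + k) (n * k))  ≡⟨ cong₂ _+_ (count-segment-arc q ≤-refl c<k)
                                                                             (cong (λ z → count c (segment z (n * k)))
                                                                                   (+-comm (q * k) k)) ⟩
    arc (t k q) k c + count c (segment (suc q * k) (n * k))              ≡⟨ cong₂ _+_ (𝟙-< (offset<k (t k q) c))
                                                                                      (count-segment-blocks (suc q) n c<k) ⟩
    suc n                                                                ∎
    where open ≡-Reasoning

  count-factor : ∀ m q {r c} → r < k → c < k →
                 count c (segment (q * k + r) (m * k)) ≡ weight m (t k q) (t k (q + m)) r c
  count-factor m q {r} {c} r<k c<k = begin
    X                                              ≡⟨ m+n∸m≡n (arc (t k q) r c) X ⟨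
    (arc (t k q) r c + X) ∸ arc (t k q) r c        ≡⟨ cong (_∸ arc (t k q) r c) (trans (sym front) back) ⟩
    (m + arc (t k (q + m)) r c) ∸ arc (t k q) r c  ∎
    where
    open ≡-Reasoning
    X = count c (segment (q * k + r) (m * k))
    front : count c (segment (q * k) (r + m * k)) ≡ arc (t k q) r c + X
    front = trans (cong (count c) (segment-++ (q * k) r (m * k)))
              (trans (count-++ c (segment (q * k) r) _) (cong (_+ X) (count-segment-arc q (<⇒≤ r<k) c<k)))
    back : count c (segment (q * k) (r + m * k)) ≡ m + arc (t k (q + m)) r c
    back = begin
      count c (segment (q * k) (r + m * k))                           ≡⟨ cong (λ z → count c (segment (q * k) z))
                                                                              (+-comm r (m * k)) ⟩
      count c (segment (q * k) (m * k + r))                           ≡⟨ cong (count c) (segment-++ (q * k) (m * k) r) ⟩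
      count c (segment (q * k) (m * k) ++ segment (q * k + m * k) r)  ≡⟨ count-++ c (segment (q * k) (m * k)) _ ⟩
      count c (segment (q * k) (m * k)) + count c (segment (q * k + m * k) r)
                                                                      ≡⟨ cong₂ _+_ (count-segment-blocks q m c<k)
                                                                           (cong (λ z → count c (segment z r))
                                                                                 (sym (*-distribʳ-+ k q m))) ⟩
      m + count c (segment ((q + m) * k) r)                           ≡⟨ cong (m +_) (count-segment-arc (q + m) (<⇒≤ r<k) c<k) ⟩
      m + arc (t k (q + m)) r c                                       ∎

  ψ-factor-digit : ∀ m q {r} → r < k → ψ k (factor k (q * k + r) (k * m)) ≡ profile m (t k q) (t k (q + m)) r
  ψ-factor-digit m q {r} r<k = map-upTo-cong _ _ λ {c} c<k → begin
    count c (factor k (q * k + r) (k * m))  ≡⟨ cong (count c) (trans (cong (factor k (q * k + r)) (*-comm k m))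
                                                                     (factor≡segment _ _)) ⟩
    count c (segment (q * k + r) (m * k))   ≡⟨ count-factor m q r<k c<k ⟩
    weight m (t k q) (t k (q + m)) r c      ∎
    where open ≡-Reasoning

  ψ-factor : ∀ m i → ψ k (factor k i (k * m)) ≡ profile m (t k (i / k)) (t k (i / k + m)) (i % k)
  ψ-factor m i = trans (cong (λ z → ψ k (factor k z (k * m))) i≡) (ψ-factor-digit m (i / k) (m%n<n i k))
    where
    i≡ : i ≡ i / k * k + i % k
    i≡ = trans (m≡m%n+[m/n]*n i k) (+-comm (i % k) (i / k * k))

-- Closed forms of the count

gapSum : ℕ → ℕ → ℕ
gapSum K h = sum (map (λ s → K * (K + 1 ∸ 2 * suc s)) (upTo h))

gapSum-suc : ∀ K h → gapSum K (suc h) ≡ gapSum K h + K * (K + 1 ∸ 2 * suc h)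
gapSum-suc K h = begin
  sum (map f (upTo (suc h)))        ≡⟨ cong (sum ∘ map f) (upTo-∷ʳ h) ⟨
  sum (map f (upTo h ++ h ∷ []))    ≡⟨ cong sum (map-++ f (upTo h) (h ∷ [])) ⟩
  sum (map f (upTo h) ++ f h ∷ [])  ≡⟨ sum-++ (map f (upTo h)) (f h ∷ []) ⟩
  gapSum K h + (f h + 0)            ≡⟨ cong (gapSum K h +_) (+-identityʳ (f h)) ⟩
  gapSum K h + f h                  ∎
  where
  open ≡-Reasoning
  f = λ s → K * (K + 1 ∸ 2 * suc s)

gapSum-closed : ∀ K h → 2 * h ≤ K + 1 → gapSum K h + K * h * h ≡ K * h * K
gapSum-closed K zero    _   = trans (*-zeroʳ (K * 0)) (sym (cong (_* K) (*-zeroʳ K)))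
gapSum-closed K (suc h) 2h≤ = +-cancelʳ-≡ K _ _ (begin
  gapSum K (suc h) + K * suc h * suc h + K        ≡⟨ cong (λ z → z + K * suc h * suc h + K) (gapSum-suc K h) ⟩
  gapSum K h + K * D + K * suc h * suc h + K      ≡⟨ expand (gapSum K h) K D h ⟩
  (gapSum K h + K * h * h) + K * (D + 2 * suc h)  ≡⟨ cong₂ _+_ (gapSum-closed K h (≤-trans (*-monoʳ-≤ 2 (n≤1+n h)) 2h≤))
                                                               (cong (K *_) (m∸n+n≡m 2h≤)) ⟩
  K * h * K + K * (K + 1)                         ≡⟨ regroup K h ⟩
  K * suc h * K + K                               ∎)
  where
  open ≡-Reasoning
  D = K + 1 ∸ 2 * suc h
  expand : ∀ S K D h → S + K * D + K * (1 + h) * (1 + h) + K ≡ (S + K * h * h) + K * (D + 2 * (1 + h))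
  expand = solve-∀
  regroup : ∀ K h → K * h * K + K * (K + 1) ≡ K * (1 + h) * K + K
  regroup = solve-∀

-- K ^ 3 and K ^ 2 are spelled out as products below, the form in which the ring solver accepts them.
gapSum-even : ∀ K h → K ≡ 2 * h → 4 * (1 + gapSum K h) ≡ 4 + K ^ 3
gapSum-even .(2 * h) h refl = +-cancelʳ-≡ (4 * (K * h * h)) _ _ (begin
  4 * (1 + gapSum K h) + 4 * (K * h * h)  ≡⟨ distrib (gapSum K h) (K * h * h) ⟩
  4 + 4 * (gapSum K h + K * h * h)        ≡⟨ cong (λ z → 4 + 4 * z) (gapSum-closed K h (m≤m+n K 1)) ⟩
  4 + 4 * (K * h * K)                     ≡⟨ cube h ⟩
  4 + K ^ 3 + 4 * (K * h * h)             ∎)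
  where
  open ≡-Reasoning
  K = 2 * h
  distrib : ∀ S X → 4 * (1 + S) + 4 * X ≡ 4 + 4 * (S + X)
  distrib = solve-∀
  cube : ∀ h → 4 + 4 * (2 * h * h * (2 * h)) ≡ 4 + 2 * h * (2 * h * (2 * h * 1)) + 4 * (2 * h * h * h)
  cube = solve-∀

gapSum-odd : ∀ K h → K ≡ 1 + 2 * h → 4 * (1 + gapSum K h) ≡ 4 + K * (K ^ 2 ∸ 1)
gapSum-odd .(1 + 2 * h) h refl = +-cancelʳ-≡ (4 * (K * h * h)) _ _ (begin
  4 * (1 + gapSum K h) + 4 * (K * h * h)       ≡⟨ distrib (gapSum K h) (K * h * h) ⟩
  4 + 4 * (gapSum K h + K * h * h)             ≡⟨ cong (λ z → 4 + 4 * z)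
                                                    (gapSum-closed K h (≤-trans (m≤n+m (2 * h) 1) (m≤m+n K 1))) ⟩
  4 + 4 * (K * h * K)                          ≡⟨ expand h ⟩
  4 + K * (4 * h * (1 + h)) + 4 * (K * h * h)  ≡⟨ cong (λ z → 4 + K * (z ∸ 1) + 4 * (K * h * h)) (square h) ⟨
  4 + K * (K ^ 2 ∸ 1) + 4 * (K * h * h)        ∎)
  where
  open ≡-Reasoning
  K = 1 + 2 * h
  distrib : ∀ S X → 4 * (1 + S) + 4 * X ≡ 4 + 4 * (S + X)
  distrib = solve-∀
  expand : ∀ h → 4 + 4 * ((1 + 2 * h) * h * (1 + 2 * h))
                 ≡ 4 + (1 + 2 * h) * (4 * h * (1 + h)) + 4 * ((1 + 2 * h) * h * h)
  expand = solve-∀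
  square : ∀ h → (1 + 2 * h) * ((1 + 2 * h) * 1) ≡ 1 + 4 * h * (1 + h)
  square = solve-∀

halves : ∀ n → n ≡ n % 2 + 2 * (n / 2)
halves n = trans (m≡m%n+[m/n]*n n 2) (cong (n % 2 +_) (*-comm (n / 2) 2))

-- Abelian factors of t^(k)

module Factors (j m : ℕ) (1≤m : 1 ≤ m) where

  open FixedPoint j
  open Cyclic k

  factor∈profiles : ∀ i → ψ k (factor k i (k * m)) ∈ profiles m
  factor∈profiles i with classify m (t k (i / k)) (t k (i / k + m)) (m%n<n i k)
  ... | inj₁ balanced-weights =
    subst (_∈ profiles m) (sym (trans (ψ-factor m i) (map-cong balanced-weights (upTo k)))) (here refl)
  ... | inj₂ (reduct a′ b′ s ab same) =
    subst (_∈ profiles m) (sym (trans (ψ-factor m i) (map-cong same (upTo k)))) (apart⇒∈ m ab)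

  apart-realised : ∀ {a b s} → Apart a b s → ∃ λ i → ψ k (factor k i (k * m)) ≡ profile m a b s
  apart-realised {a} {b} {s} ab with realise {m} 1≤m (m%n<n a k) (m%n<n b k)
  ... | q , t-q , t-q+m = q * k + s , trans (ψ-factor-digit m q s<k) (map-cong same (upTo k))
    where
    s<k : s < k
    s<k = <-≤-trans (m<m+n s (Apart.1≤s ab)) (apart-2s≤k ab)
    same : ∀ c → weight m (t k q) (t k (q + m)) s c ≡ weight m a b s c
    same c = weight-cong m {t k q} {a} {t k (q + m)} {b} s c
               (trans (cong (_% k) t-q) (m%k≈m a)) (trans (cong (_% k) t-q+m) (m%k≈m b))

  profiles-realised : ∀ {v} → v ∈ profiles m → ∃ λ i → ψ k (factor k i (k * m)) ≡ v
  profiles-realised (here refl) = 0 , trans (ψ-factor m 0) (map-cong (weight-empty m (t k 0) (t k m)) (upTo k))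
  profiles-realised (there v∈) with ∈-map⁻ (profileAt m) v∈
  ... | x , x∈ , refl = apart-realised (valid⇒apart (∈-indices⁻ x∈))

  ∈-profiles⇔ : ∀ v → v ∈ profiles m ⇔ ∃ λ i → ψ k (factor k i (k * m)) ≡ v
  ∈-profiles⇔ v = mk⇔ profiles-realised (λ (i , eq) → subst (_∈ profiles m) eq (factor∈profiles i))

lemma3 : (k m : ℕ) → 2 ≤ k → 1 ≤ m →
    Σ (List (List ℕ)) λ L →
      Unique L
      × (∀ v → (v ∈ L) ⇔ (∃ λ i → ψ k (factor k i (k * m)) ≡ v))
      × length L ≡ 1 + sum (map (λ s → k * (k + 1 ∸ 2 * suc s)) (upTo (k / 2)))
      × (k % 2 ≡ 0 → 4 * length L ≡ 4 + k ^ 3)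
      × (k % 2 ≡ 1 → 4 * length L ≡ 4 + k * (k ^ 2 ∸ 1))
lemma3 k@(suc (suc j)) m (s≤s (s≤s z≤n)) 1≤m =
  profiles m , profiles-unique 1≤m , ∈-profiles⇔ , length-profiles m ,
  (λ even → trans 4*length≡ (gapSum-even k (k / 2) (trans (halves k) (cong (_+ 2 * (k / 2)) even)))) ,
  (λ odd  → trans 4*length≡ (gapSum-odd k (k / 2) (trans (halves k) (cong (_+ 2 * (k / 2)) odd))))
  where
  open Cyclic k using (profiles; profiles-unique; length-profiles)
  open Factors j m 1≤m using (∈-profiles⇔)
  4*length≡ : 4 * length (profiles m) ≡ 4 * (1 + gapSum k (k / 2))
  4*length≡ = cong (4 *_) (length-profiles m)
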